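{- Let $d\ge2$. There are at most $n^n$ non-constant $d$-adic distributions over $X_n=\{x_1,\dots,x_n\}$.
   Context: A distribution $\mu$ on $X_n$ is $d$-adic if every element with non-zero probability has probability $d^{ -\ell}$ for some positive integer $\ell$. -}

module Defs where

open import Data.Nat using (ℕ; zero; suc; _^_; _≤_)
open import Data.Fin using (Fin; zero; suc)
open import Data.Rational using (ℚ; 0ℚ; 1ℚ; _+_; _*_; _≥_; _/_)
open import Data.Integer using (+_)
open import Data.Product using (Σ; _×_; ∃-syntax)
open import Data.Sum using (_⊎_)
open import Relation.Binary.PropositionalEquality using (_≡_)
open import Relation.Nullary using (¬_)

sumℚ : (n : ℕ) → (Fin n → ℚ) → ℚ
sumℚ zero    f = 0ℚ
sumℚ (suc n) f = f zero + sumℚ n (λ i → f (suc i))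

-- a probability distribution on X_n = Fin n (x_{i+1} ↔ i)
IsDistribution : (n : ℕ) → (Fin n → ℚ) → Set
IsDistribution n μ = (∀ i → μ i ≥ 0ℚ) × sumℚ n μ ≡ 1ℚ

-- every element of non-zero probability has probability d^{-ℓ}, ℓ ≥ 1
-- (μ i = d^{-ℓ} written as μ i * d^ℓ = 1)
IsDAdic : (d n : ℕ) → (Fin n → ℚ) → Set
IsDAdic d n μ = ∀ i → μ i ≡ 0ℚ ⊎ (∃[ ℓ ] (1 ≤ ℓ × μ i * (+ (d ^ ℓ) / 1) ≡ 1ℚ))

IsConstant : (n : ℕ) → (Fin n → ℚ) → Set
IsConstant n μ = ∃[ i ] (μ i ≡ 1ℚ)

NonConstantDAdicDistribution : (d n : ℕ) → (Fin n → ℚ) → Set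
NonConstantDAdicDistribution d n μ =
  IsDistribution n μ × IsDAdic d n μ × ¬ IsConstant n μ

Different : (n : ℕ) → (Fin n → ℚ) → (Fin n → ℚ) → Set
Different n μ ν = ¬ (∀ i → μ i ≡ ν i)

-- Write the non-zero probabilities of a d-adic distribution as d^-ℓᵢ and let M ≥ every ℓᵢ.
-- Then Σᵢ d^(M-ℓᵢ) = d^M. Whenever a sum of k powers of d is divisible by d^(a+j) and one
-- of the powers is d^a, we have j < k: the number of terms d⁰ must be divisible by d, so
-- merging them d at a time and dividing by d keeps the hypothesis with a-1 (or j-1 once
-- a = 0, where the merging strictly shortens the list). Taking a = M-ℓᵢ, j = ℓᵢ gives
-- ℓᵢ < n, so i ↦ ℓᵢ (with ℓᵢ = 0 for probability 0) is a function Fin n → Fin n, and it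
-- determines the distribution.
{-# OPTIONS --safe #-}
module Submission where

open import Defs
open import Data.Nat using (ℕ; zero; suc; _+_; _*_; _∸_; _^_; _≤_; _<_; _≤?_; z≤n; z<s; s≤s; NonZero; >-nonZero)
open import Data.Nat.Properties
  using (≤-reflexive; ≤-trans; ≤-<-trans; m≤m+n; m≤n+m; m≤m*n; m<m*n; +-suc; +-comm; *-zeroʳ; *-identityʳ;
         +-monoˡ-≤; +-monoˡ-<; m∸n+n≡m; m+[n∸m]≡n; ^-distribˡ-+-*; m<n⇒n≢0; ≰⇒>; module ≤-Reasoning)
open import Data.Nat.Divisibility using (_∣_; divides; ∣-reflexive; ∣-trans; m∣m*n; ∣m+n∣m⇒∣n; *-cancelˡ-∣)
open import Data.Nat.Coprimality using (1-coprimeTo) renaming (sym to coprime-sym)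
open import Data.Nat.ListAction using (sum)
open import Data.Nat.Solver using (module +-*-Solver)
open import Data.Integer using (+_; ∣_∣)
open import Data.Integer.Properties using (+◃n≡+n)
open import Data.Rational as ℚ using (ℚ; mkℚ; 0ℚ; 1ℚ; _/_; ↥_)
import Data.Rational.Properties as ℚ
open import Data.Fin using (Fin; toℕ; fromℕ<; funToFin; finToFun)
open import Data.Fin.Properties using (toℕ<n; toℕ-fromℕ<; finToFun-funToFin; pigeonhole)
import Data.Fin as Fin
open import Data.Maybe using (Maybe; just; nothing; maybe′)
open import Data.Maybe.Relation.Unary.Any using (just) renaming (Any to MAny)
open import Data.List using (List; []; _∷_; length; map; replicate; _++_; tabulate; catMaybes; lookup)
open import Data.List.Properties using (length-++; length-replicate; length-tabulate; length-catMaybes; map-tabulate; Any-catMaybes⁺)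
open import Data.List.Membership.Propositional using (_∈_)
open import Data.List.Membership.Propositional.Properties using (∈-++⁺ʳ; ∈-lookup)
open import Data.List.Relation.Unary.All as All using (All)
open import Data.List.Relation.Unary.AllPairs using (AllPairs; _∷_)
open import Data.List.Relation.Unary.Any using (here; there)
import Data.List.Relation.Unary.Any.Properties as Any
open import Data.Product using (_×_; _,_; proj₁; proj₂; ∃-syntax)
open import Data.Sum using (_⊎_; inj₁; inj₂)
open import Data.Empty using (⊥-elim)
open import Function using (_∘_)
open import Relation.Nullary using (¬_; yes; no; contradiction)
open import Relation.Binary.PropositionalEquality using (_≡_; refl; sym; trans; cong; cong₂; subst; module ≡-Reasoning)

private
  variable
    A : Set
    a m n : ℕ
    xs : List A

fromℕ : ℕ → ℚ
fromℕ m = + m / 1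

fromℕ≡mkℚ : ∀ m → fromℕ m ≡ mkℚ (+ m) 0 (coprime-sym (1-coprimeTo m))
fromℕ≡mkℚ m = ℚ.normalize-coprime (coprime-sym (1-coprimeTo m))

fromℕ-+ : ∀ m n → fromℕ (m + n) ≡ fromℕ m ℚ.+ fromℕ n
fromℕ-+ m n rewrite fromℕ≡mkℚ m | fromℕ≡mkℚ n
                  | +◃n≡+n (m * 1) | +◃n≡+n (n * 1) | *-identityʳ m | *-identityʳ n = refl

fromℕ-* : ∀ m n → fromℕ (m * n) ≡ fromℕ m ℚ.* fromℕ n
fromℕ-* m n rewrite fromℕ≡mkℚ m | fromℕ≡mkℚ n = cong (_/ 1) (sym (+◃n≡+n (m * n)))

fromℕ-injective : fromℕ m ≡ fromℕ n → m ≡ n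
fromℕ-injective {m} {n} eq = cong (λ r → ∣ ↥ r ∣) (trans (sym (fromℕ≡mkℚ m)) (trans eq (fromℕ≡mkℚ n)))

fromℕ-sum-tabulate : (f : Fin n → ℕ) → fromℕ (sum (tabulate f)) ≡ sumℚ n (fromℕ ∘ f)
fromℕ-sum-tabulate {zero}  f = refl
fromℕ-sum-tabulate {suc n} f =
  trans (fromℕ-+ (f Fin.zero) _) (cong (fromℕ (f Fin.zero) ℚ.+_) (fromℕ-sum-tabulate (f ∘ Fin.suc)))

sumℚ-cong : {f g : Fin n → ℚ} → (∀ i → f i ≡ g i) → sumℚ n f ≡ sumℚ n g
sumℚ-cong {zero}  f≗g = refl
sumℚ-cong {suc n} f≗g = cong₂ ℚ._+_ (f≗g Fin.zero) (sumℚ-cong (f≗g ∘ Fin.suc))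

sumℚ-*ʳ : (f : Fin n → ℚ) (r : ℚ) → sumℚ n f ℚ.* r ≡ sumℚ n (λ i → f i ℚ.* r)
sumℚ-*ʳ {zero}  f r = ℚ.*-zeroˡ r
sumℚ-*ʳ {suc n} f r =
  trans (ℚ.*-distribʳ-+ r (f Fin.zero) _) (cong (f Fin.zero ℚ.* r ℚ.+_) (sumℚ-*ʳ (f ∘ Fin.suc) r))

*-inverseʳ-unique : ∀ {p q r} → p ℚ.* r ≡ 1ℚ → q ℚ.* r ≡ 1ℚ → p ≡ q
*-inverseʳ-unique {p} {q} {r} pr≡1 qr≡1 = begin
  p                ≡⟨ ℚ.*-identityʳ p ⟨
  p ℚ.* 1ℚ         ≡⟨ cong (p ℚ.*_) qr≡1 ⟨
  p ℚ.* (q ℚ.* r)  ≡⟨ cong (p ℚ.*_) (ℚ.*-comm q r) ⟩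
  p ℚ.* (r ℚ.* q)  ≡⟨ ℚ.*-assoc p r q ⟨
  (p ℚ.* r) ℚ.* q  ≡⟨ cong (ℚ._* q) pr≡1 ⟩
  1ℚ ℚ.* q         ≡⟨ ℚ.*-identityˡ q ⟩
  q                ∎
  where open ≡-Reasoning

≤-sum-tabulate : (f : Fin n → ℕ) (i : Fin n) → f i ≤ sum (tabulate f)
≤-sum-tabulate f Fin.zero    = m≤m+n _ _
≤-sum-tabulate f (Fin.suc i) = ≤-trans (≤-sum-tabulate (f ∘ Fin.suc) i) (m≤n+m _ _)

∈-catMaybes-tabulate : {f : Fin n → Maybe A} {x : A} (i : Fin n) → f i ≡ just x → x ∈ catMaybes (tabulate f)
∈-catMaybes-tabulate {x = x} i fi≡x = Any-catMaybes⁺ (Any.tabulate⁺ i (subst (MAny (x ≡_)) (sym fi≡x) (just refl)))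

funToFin-injective : {f g : Fin m → Fin n} → funToFin f ≡ funToFin g → ∀ i → f i ≡ g i
funToFin-injective {f = f} {g} f≡g i =
  trans (sym (finToFun-funToFin f i)) (trans (cong (λ c → finToFun c i) f≡g) (finToFun-funToFin g i))

AllPairs-lookup : {R : A → A → Set} → AllPairs R xs → {i j : Fin (length xs)} → i Fin.< j → R (lookup xs i) (lookup xs j)
AllPairs-lookup (Rx ∷ _)   {Fin.zero}  {Fin.suc j} _         = All.lookup Rx (∈-lookup j)
AllPairs-lookup (_  ∷ Rxs) {Fin.suc i} {Fin.suc j} (s≤s i<j) = AllPairs-lookup Rxs i<j

length≤-by-code : {P : A → Set} {R : A → A → Set} (code : ∀ {x} → P x → Fin m) →
                  (∀ {x y} (px : P x) (py : P y) → code px ≡ code py → ¬ R x y) →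
                  All P xs → AllPairs R xs → length xs ≤ m
length≤-by-code {m = m} {xs = xs} code separates Pxs Rxs with length xs ≤? m
... | yes ≤m = ≤m
... | no  ≰m with i , j , i<j , codes≡ ← pigeonhole (≰⇒> ≰m) (λ k → code (All.lookup Pxs (∈-lookup k)))
  = ⊥-elim (separates _ _ codes≡ (AllPairs-lookup Rxs i<j))

module PowerSums (d : ℕ) where

  powerSum : List ℕ → ℕ
  powerSum = sum ∘ map (d ^_)

  zeroCount : List ℕ → ℕ
  zeroCount []           = 0
  zeroCount (zero  ∷ xs) = suc (zeroCount xs)
  zeroCount (suc _ ∷ xs) = zeroCount xs

  lowered : List ℕ → List ℕ
  lowered []           = []
  lowered (zero  ∷ xs) = lowered xs
  lowered (suc x ∷ xs) = x ∷ lowered xs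

  powerSum-lowered : ∀ xs → powerSum xs ≡ zeroCount xs + d * powerSum (lowered xs)
  powerSum-lowered []           = sym (*-zeroʳ d)
  powerSum-lowered (zero  ∷ xs) = cong suc (powerSum-lowered xs)
  powerSum-lowered (suc x ∷ xs) rewrite powerSum-lowered xs =
    solve 4 (λ D P Z R → D :* P :+ (Z :+ D :* R) := Z :+ D :* (P :+ R)) refl
      d (d ^ x) (zeroCount xs) (powerSum (lowered xs))
    where open +-*-Solver

  length-lowered : ∀ xs → length xs ≡ zeroCount xs + length (lowered xs)
  length-lowered []           = refl
  length-lowered (zero  ∷ xs) = cong suc (length-lowered xs)
  length-lowered (suc _ ∷ xs) = trans (cong suc (length-lowered xs)) (sym (+-suc _ _))

  ∈-lowered : ∀ {xs} → suc a ∈ xs → a ∈ lowered xs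
  ∈-lowered {xs = zero  ∷ _} (there sa∈xs) = ∈-lowered sa∈xs
  ∈-lowered {xs = suc _ ∷ _} (here refl)   = here refl
  ∈-lowered {xs = suc _ ∷ _} (there sa∈xs) = there (∈-lowered sa∈xs)

  zeroCount>0 : ∀ {xs} → 0 ∈ xs → 0 < zeroCount xs
  zeroCount>0 {xs = zero  ∷ _} _          = z<s
  zeroCount>0 {xs = suc _ ∷ _} (there 0∈xs) = zeroCount>0 0∈xs

  zeroCount-divisible : ∀ xs → d ∣ powerSum xs → d ∣ zeroCount xs
  zeroCount-divisible xs d∣sum = ∣m+n∣m⇒∣n d∣sum′ (m∣m*n _)
    where
    d∣sum′ : d ∣ d * powerSum (lowered xs) + zeroCount xs
    d∣sum′ = subst (d ∣_) (trans (powerSum-lowered xs) (+-comm (zeroCount xs) _)) d∣sum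

  -- With q · d exponents 0, merging them d at a time into q copies of d¹ and then lowering
  -- every exponent by one divides the power sum by d.
  carry : ℕ → List ℕ → List ℕ
  carry q xs = replicate q 0 ++ lowered xs

  powerSum-replicate-0 : ∀ q xs → powerSum (replicate q 0 ++ xs) ≡ q + powerSum xs
  powerSum-replicate-0 zero    xs = refl
  powerSum-replicate-0 (suc q) xs = cong suc (powerSum-replicate-0 q xs)

  powerSum-carry : ∀ q xs → zeroCount xs ≡ q * d → d * powerSum (carry q xs) ≡ powerSum xs
  powerSum-carry q xs zeros≡ = begin
    d * powerSum (carry q xs)             ≡⟨ cong (d *_) (powerSum-replicate-0 q (lowered xs)) ⟩
    d * (q + powerSum (lowered xs))       ≡⟨ solve 3 (λ D Q R → D :* (Q :+ R) := Q :* D :+ D :* R) refl d q _ ⟩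
    q * d + d * powerSum (lowered xs)     ≡⟨ cong (_+ d * powerSum (lowered xs)) zeros≡ ⟨
    zeroCount xs + d * powerSum (lowered xs) ≡⟨ powerSum-lowered xs ⟨
    powerSum xs                           ∎
    where
    open ≡-Reasoning
    open +-*-Solver

  length-carry : ∀ q xs → length (carry q xs) ≡ q + length (lowered xs)
  length-carry q xs = trans (length-++ (replicate q 0)) (cong (_+ length (lowered xs)) (length-replicate q))

  module _ (1<d : 1 < d) where

    private instance
      d≢0 : NonZero d
      d≢0 = >-nonZero (≤-<-trans z≤n 1<d)

    length-carry≤ : ∀ q xs → zeroCount xs ≡ q * d → length (carry q xs) ≤ length xs
    length-carry≤ q xs zeros≡ = begin
      length (carry q xs)                ≡⟨ length-carry q xs ⟩
      q + length (lowered xs)            ≤⟨ +-monoˡ-≤ _ (m≤m*n q d) ⟩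
      q * d + length (lowered xs)        ≡⟨ cong (_+ length (lowered xs)) zeros≡ ⟨
      zeroCount xs + length (lowered xs) ≡⟨ length-lowered xs ⟨
      length xs                          ∎
      where open ≤-Reasoning

    length-carry< : ∀ q xs → zeroCount xs ≡ suc q * d → length (carry (suc q) xs) < length xs
    length-carry< q xs zeros≡ = begin-strict
      length (carry (suc q) xs)          ≡⟨ length-carry (suc q) xs ⟩
      suc q + length (lowered xs)        <⟨ +-monoˡ-< _ (m<m*n (suc q) d 1<d) ⟩
      suc q * d + length (lowered xs)    ≡⟨ cong (_+ length (lowered xs)) zeros≡ ⟨
      zeroCount xs + length (lowered xs) ≡⟨ length-lowered xs ⟨
      length xs                          ∎
      where open ≤-Reasoning

    record Carry (xs : List ℕ) : Set where
      field
        carried          : List ℕ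
        powerSum-carried : d * powerSum carried ≡ powerSum xs
        length-carried≤  : length carried ≤ length xs
        ∈-carried        : suc a ∈ xs → a ∈ carried
        0∈-carried       : 0 ∈ xs → 0 ∈ carried × length carried < length xs

      ^∣powerSum-carried : ∀ k → d ^ suc k ∣ powerSum xs → d ^ k ∣ powerSum carried
      ^∣powerSum-carried k dᵏ⁺¹∣sum = *-cancelˡ-∣ d (subst (d * d ^ k ∣_) (sym powerSum-carried) dᵏ⁺¹∣sum)

    carry-divisible : ∀ xs → d ∣ powerSum xs → Carry xs
    carry-divisible xs d∣sum with zeroCount-divisible xs d∣sum
    ... | divides q zeros≡ = record
      { carried          = carry q xs
      ; powerSum-carried = powerSum-carry q xs zeros≡
      ; length-carried≤  = length-carry≤ q xs zeros≡
      ; ∈-carried        = ∈-++⁺ʳ (replicate q 0) ∘ ∈-lowered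
      ; 0∈-carried       = 0∈-carry q zeros≡
      }
      where
      0∈-carry : ∀ q → zeroCount xs ≡ q * d → 0 ∈ xs → 0 ∈ carry q xs × length (carry q xs) < length xs
      0∈-carry zero    zeros≡ 0∈xs = contradiction zeros≡ (m<n⇒n≢0 (zeroCount>0 0∈xs))
      0∈-carry (suc q) zeros≡ _    = here refl , length-carry< q xs zeros≡

    ^∣powerSum⇒<length : ∀ a j xs → a ∈ xs → d ^ (a + j) ∣ powerSum xs → j < length xs
    ^∣powerSum⇒<length a       zero    (_ ∷ _) _ _ = z<s
    ^∣powerSum⇒<length zero    (suc j) xs 0∈xs  dʲ⁺¹∣sum =
      ≤-<-trans (^∣powerSum⇒<length 0 j carried (proj₁ (0∈-carried 0∈xs)) (^∣powerSum-carried j dʲ⁺¹∣sum))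
                (proj₂ (0∈-carried 0∈xs))
      where open Carry (carry-divisible xs (∣-trans (m∣m*n _) dʲ⁺¹∣sum))
    ^∣powerSum⇒<length (suc a) (suc j) xs sa∈xs dᵃ⁺ʲ⁺²∣sum =
      ≤-trans (^∣powerSum⇒<length a (suc j) carried (∈-carried sa∈xs) (^∣powerSum-carried (a + suc j) dᵃ⁺ʲ⁺²∣sum))
              length-carried≤
      where open Carry (carry-divisible xs (∣-trans (m∣m*n _) dᵃ⁺ʲ⁺²∣sum))

  powerSum-catMaybes : (ms : List (Maybe ℕ)) → powerSum (catMaybes ms) ≡ sum (map (maybe′ (d ^_) 0) ms)
  powerSum-catMaybes []             = refl
  powerSum-catMaybes (nothing ∷ ms) = powerSum-catMaybes ms
  powerSum-catMaybes (just x  ∷ ms) = cong (_+_ (d ^ x)) (powerSum-catMaybes ms)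

-- IsDAdic d n μ unfolds to ∀ i → IsDAdicValue d (μ i).
IsDAdicValue : ℕ → ℚ → Set
IsDAdicValue d p = p ≡ 0ℚ ⊎ ∃[ ℓ ] (1 ≤ ℓ × p ℚ.* fromℕ (d ^ ℓ) ≡ 1ℚ)

module _ {d : ℕ} where

  exponent : ∀ {p} → IsDAdicValue d p → ℕ
  exponent (inj₁ _)       = 0
  exponent (inj₂ (ℓ , _)) = ℓ

  exponent-injective : ∀ {p r} (v : IsDAdicValue d p) (w : IsDAdicValue d r) → exponent v ≡ exponent w → p ≡ r
  exponent-injective (inj₁ refl)          (inj₁ refl)          _    = refl
  exponent-injective (inj₁ _)             (inj₂ (_ , 1≤ℓ , _)) 0≡ℓ  = contradiction (sym 0≡ℓ) (m<n⇒n≢0 1≤ℓ)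
  exponent-injective (inj₂ (_ , 1≤ℓ , _)) (inj₁ _)             ℓ≡0  = contradiction ℓ≡0 (m<n⇒n≢0 1≤ℓ)
  exponent-injective (inj₂ (_ , _ , pdˡ≡1)) (inj₂ (_ , _ , rdˡ≡1)) refl = *-inverseʳ-unique pdˡ≡1 rdˡ≡1

  scaledExponent : ∀ {p} → ℕ → IsDAdicValue d p → Maybe ℕ
  scaledExponent M (inj₁ _)       = nothing
  scaledExponent M (inj₂ (ℓ , _)) = just (M ∸ ℓ)

  fromℕ-scaledExponent : ∀ {p} M (v : IsDAdicValue d p) → exponent v ≤ M →
                         fromℕ (maybe′ (d ^_) 0 (scaledExponent M v)) ≡ p ℚ.* fromℕ (d ^ M)
  fromℕ-scaledExponent M (inj₁ refl) _ = sym (ℚ.*-zeroˡ (fromℕ (d ^ M)))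
  fromℕ-scaledExponent {p} M (inj₂ (ℓ , _ , pdˡ≡1)) ℓ≤M = begin
    fromℕ (d ^ (M ∸ ℓ))                       ≡⟨ ℚ.*-identityˡ _ ⟨
    1ℚ ℚ.* fromℕ (d ^ (M ∸ ℓ))                ≡⟨ cong (ℚ._* fromℕ (d ^ (M ∸ ℓ))) pdˡ≡1 ⟨
    p ℚ.* fromℕ (d ^ ℓ) ℚ.* fromℕ (d ^ (M ∸ ℓ)) ≡⟨ ℚ.*-assoc p _ _ ⟩
    p ℚ.* (fromℕ (d ^ ℓ) ℚ.* fromℕ (d ^ (M ∸ ℓ))) ≡⟨ cong (p ℚ.*_) (fromℕ-* (d ^ ℓ) _) ⟨
    p ℚ.* fromℕ (d ^ ℓ * d ^ (M ∸ ℓ))         ≡⟨ cong (λ e → p ℚ.* fromℕ e) (^-distribˡ-+-* d ℓ (M ∸ ℓ)) ⟨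
    p ℚ.* fromℕ (d ^ (ℓ + (M ∸ ℓ)))           ≡⟨ cong (λ e → p ℚ.* fromℕ (d ^ e)) (m+[n∸m]≡n ℓ≤M) ⟩
    p ℚ.* fromℕ (d ^ M)                       ∎
    where open ≡-Reasoning

module _ {d n : ℕ} {μ : Fin n → ℚ} (dAdic : IsDAdic d n μ) (sum≡1 : sumℚ n μ ≡ 1ℚ) where

  open PowerSums d

  private
    M : ℕ
    M = sum (tabulate (exponent ∘ dAdic))

    scaled : Fin n → Maybe ℕ
    scaled = scaledExponent M ∘ dAdic

    scaledExponents : List ℕ
    scaledExponents = catMaybes (tabulate scaled)

    powerSum-scaledExponents : powerSum scaledExponents ≡ d ^ M
    powerSum-scaledExponents = fromℕ-injective (begin
      fromℕ (powerSum scaledExponents)                     ≡⟨ cong fromℕ (powerSum-catMaybes (tabulate scaled)) ⟩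
      fromℕ (sum (map (maybe′ (d ^_) 0) (tabulate scaled))) ≡⟨ cong (fromℕ ∘ sum) (map-tabulate scaled _) ⟩
      fromℕ (sum (tabulate (maybe′ (d ^_) 0 ∘ scaled)))     ≡⟨ fromℕ-sum-tabulate (maybe′ (d ^_) 0 ∘ scaled) ⟩
      sumℚ n (fromℕ ∘ maybe′ (d ^_) 0 ∘ scaled)
        ≡⟨ sumℚ-cong (λ i → fromℕ-scaledExponent M (dAdic i) (≤-sum-tabulate (exponent ∘ dAdic) i)) ⟩
      sumℚ n (λ i → μ i ℚ.* fromℕ (d ^ M))                 ≡⟨ sumℚ-*ʳ μ (fromℕ (d ^ M)) ⟨
      sumℚ n μ ℚ.* fromℕ (d ^ M)                           ≡⟨ cong (ℚ._* fromℕ (d ^ M)) sum≡1 ⟩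
      1ℚ ℚ.* fromℕ (d ^ M)                                 ≡⟨ ℚ.*-identityˡ _ ⟩
      fromℕ (d ^ M)                                        ∎)
      where open ≡-Reasoning

    length-scaledExponents : length scaledExponents ≤ n
    length-scaledExponents = ≤-trans (length-catMaybes (tabulate scaled)) (≤-reflexive (length-tabulate scaled))

  exponent<n : 1 < d → ∀ i → exponent (dAdic i) < n
  exponent<n 1<d i with dAdic i in dAdicᵢ≡
  ... | inj₁ _       = ≤-<-trans z≤n (toℕ<n i)
  ... | inj₂ (ℓ , _) = begin-strict
    ℓ                        <⟨ ^∣powerSum⇒<length 1<d (M ∸ ℓ) ℓ scaledExponents M∸ℓ∈ dᴹ∣sum ⟩
    length scaledExponents   ≤⟨ length-scaledExponents ⟩
    n                        ∎
    where
    open ≤-Reasoning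
    ℓ≤M : ℓ ≤ M
    ℓ≤M = subst (_≤ M) (cong exponent dAdicᵢ≡) (≤-sum-tabulate (exponent ∘ dAdic) i)
    M∸ℓ∈ : M ∸ ℓ ∈ scaledExponents
    M∸ℓ∈ = ∈-catMaybes-tabulate i (cong (scaledExponent M) dAdicᵢ≡)
    dᴹ∣sum : d ^ ((M ∸ ℓ) + ℓ) ∣ powerSum scaledExponents
    dᴹ∣sum = ∣-reflexive (trans (cong (d ^_) (m∸n+n≡m ℓ≤M)) (sym powerSum-scaledExponents))

module _ {d n : ℕ} (1<d : 1 < d) where

  exponentCode : ∀ {μ} → NonConstantDAdicDistribution d n μ → Fin (n ^ n)
  exponentCode ((_ , sum≡1) , dAdic , _) = funToFin (λ i → fromℕ< (exponent<n dAdic sum≡1 1<d i))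

  exponentCode-injective : ∀ {μ ν} (pμ : NonConstantDAdicDistribution d n μ) (pν : NonConstantDAdicDistribution d n ν) →
                           exponentCode pμ ≡ exponentCode pν → ∀ i → μ i ≡ ν i
  exponentCode-injective ((_ , μ-sum≡1) , μ-dAdic , _) ((_ , ν-sum≡1) , ν-dAdic , _) codes≡ i =
    exponent-injective (μ-dAdic i) (ν-dAdic i) (begin
      exponent (μ-dAdic i)           ≡⟨ toℕ-fromℕ< μ-bound ⟨
      toℕ (fromℕ< μ-bound)           ≡⟨ cong toℕ (funToFin-injective codes≡ i) ⟩
      toℕ (fromℕ< ν-bound)           ≡⟨ toℕ-fromℕ< ν-bound ⟩
      exponent (ν-dAdic i)           ∎)
    where
    open ≡-Reasoning
    μ-bound : exponent (μ-dAdic i) < n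
    μ-bound = exponent<n μ-dAdic μ-sum≡1 1<d i
    ν-bound : exponent (ν-dAdic i) < n
    ν-bound = exponent<n ν-dAdic ν-sum≡1 1<d i

lemma6p7 : (d : ℕ) → 2 ≤ d → (n : ℕ) → (L : List (Fin n → ℚ)) →
    All (NonConstantDAdicDistribution d n) L →
    AllPairs (Different n) L →
    length L ≤ n ^ n
lemma6p7 d 1<d n L =
  length≤-by-code (exponentCode 1<d) (λ pμ pν codes≡ different → different (exponentCode-injective 1<d pμ pν codes≡))
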